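{- Define $G_2=\mathbb{Z}[\omega_2]\cup\big(\mathbb{Z}[\omega_2]+\tfrac{\omega_2}2\big)$, $G_7=\mathbb{Z}[\omega_7]\cup\big(\mathbb{Z}[\omega_7]+\tfrac{\omega_7}2\big)$ and $G_{11}=\mathbb{Z}[\omega_{11}]\cup\big(\mathbb{Z}[\omega_{11}]+\tfrac{\omega_{11}}3\big)\cup\big(\mathbb{Z}[\omega_{11}]+\tfrac{\omega_{11}}2\big)\cup\big(\mathbb{Z}[\omega_{11}]+\tfrac{2\omega_{11}}3\big)$. Then for $d\in\{2,7,11\}$ the subgraph of $\mathcal{E}_d$ induced on the vertex set $G_d$ is connected.
   Context: $\omega_2=\sqrt{ -2}$, $\omega_7=\frac{1+\sqrt{ -7}}2$, $\omega_{11}=\frac{1+\sqrt{ -11}}2$. The Farey graph $\mathcal{E}_d$ has vertex set $\mathbb{Q}(\sqrt{ -d})\cup\{\infty\}$ and edges $A(\infty)\to A(0)$ for $A\in\mathrm{PSL}(2,\mathbb{Z}[\omega_d])$ acting by Möbius transformations (an undirected relation). -}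

module Defs where

open import Data.Integer as ℤ using (ℤ; +_)
open import Data.Rational as ℚ using (ℚ; 0ℚ; 1ℚ)
open import Data.Product using (Σ; _×_; _,_; proj₁)
open import Data.Empty using (⊥)
open import Data.Sum using (_⊎_)
open import Data.List using (List; _∷_; [])
open import Data.List.Membership.Propositional using (_∈_)
open import Relation.Binary.PropositionalEquality using (_≡_; _≢_)
open import Relation.Binary.Construct.Closure.ReflexiveTransitive using (Star)

data D : Set where
  d2 d7 d11 : D

-- ω_d satisfies ω² = T·ω − N :
--   ω₂ = √-2 : ω² = −2 ;  ω₇ = (1+√-7)/2 : ω² = ω − 2 ;  ω₁₁ = (1+√-11)/2 : ω² = ω − 3.
Tr : D → ℤ
Tr d2  = + 0
Tr d7  = + 1
Tr d11 = + 1

Nm : D → ℤ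
Nm d2  = + 2
Nm d7  = + 2
Nm d11 = + 3

-- Ring of integers ℤ[ω_d]: the pair (m , n) stands for m + n·ω_d.
O : Set
O = ℤ × ℤ

oadd : O → O → O
oadd (a , b) (c , e) = (a ℤ.+ c , b ℤ.+ e)

osub : O → O → O
osub (a , b) (c , e) = (a ℤ.- c , b ℤ.- e)

omul : D → O → O → O
omul d (a , b) (c , e) =
  (a ℤ.* c ℤ.- Nm d ℤ.* (b ℤ.* e) , a ℤ.* e ℤ.+ b ℤ.* c ℤ.+ Tr d ℤ.* (b ℤ.* e))

oone : O
oone = (+ 1 , + 0)

-- The field ℚ(√-d) = ℚ(ω_d): the pair (u , v) stands for u + v·ω_d.
K : Set
K = ℚ × ℚ

kmul : D → K → K → K
kmul d (a , b) (c , e) =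
  (a ℚ.* c ℚ.- ((Nm d) ℚ./ 1) ℚ.* (b ℚ.* e) , a ℚ.* e ℚ.+ b ℚ.* c ℚ.+ ((Tr d) ℚ./ 1) ℚ.* (b ℚ.* e))

kzero : K
kzero = (0ℚ , 0ℚ)

emb : O → K
emb (m , n) = ((m ℚ./ 1) , (n ℚ./ 1))

data P¹ : Set where
  ∞   : P¹
  fin : K → P¹

record Mat : Set where
  constructor mat
  field
    a b c e : O

det : D → Mat → O
det d (mat a b c e) = osub (omul d a e) (omul d b c)

HomPt : D → O → O → P¹ → Set
HomPt d num den ∞       = emb den ≡ kzero
HomPt d num den (fin x) = (emb den ≢ kzero) × (kmul d x (emb den) ≡ emb num)

-- Möbius action: A(∞) = [a : c], A(0) = [b : e].
ImInf : D → Mat → P¹ → Set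
ImInf d (mat a b c e) p = HomPt d a c p

ImZero : D → Mat → P¹ → Set
ImZero d (mat a b c e) p = HomPt d b e p

-- Directed relation  A(∞) → A(0)  for A ∈ SL(2, ℤ[ω_d]) (same images as PSL).
Arrow : D → P¹ → P¹ → Set
Arrow d x y = Σ Mat λ A → (det d A ≡ oone) × ImInf d A x × ImZero d A y

Edge : D → P¹ → P¹ → Set
Edge d x y = Arrow d x y ⊎ Arrow d y x

half third twothirds : ℚ
half      = + 1 ℚ./ 2
third     = + 1 ℚ./ 3
twothirds = + 2 ℚ./ 3

offsets : D → List ℚ
offsets d2  = 0ℚ ∷ half ∷ []
offsets d7  = 0ℚ ∷ half ∷ []
offsets d11 = 0ℚ ∷ third ∷ half ∷ twothirds ∷ []

InG : D → P¹ → Set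
InG d ∞       = ⊥
InG d (fin x) = Σ O λ z → Σ ℚ λ t → (t ∈ offsets d) × (x ≡ kadd (emb z) (0ℚ , t))
  where
  kadd : K → K → K
  kadd (p , q) (r , s) = (p ℚ.+ r , q ℚ.+ s)

GV : D → Set
GV d = Σ P¹ (InG d)

GEdge : (d : D) → GV d → GV d → Set
GEdge d x y = Edge d (proj₁ x) (proj₁ y)

InducedConnected : D → Set
InducedConnected d = (x y : GV d) → Star (GEdge d) x y

-- Translation by u ∈ ℤ[ω] comes from the unimodular matrix (1 u ; 0 1), so it is an
-- automorphism of 𝓔_d, and it maps G_d onto itself. It therefore suffices to join 0 to 1,
-- to ω and to each coset representative tω by explicit walks inside G_d: translating
-- these along ℤ[ω] = ℤ ⊕ ℤω joins every vertex of G_d to 0.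

module Submission where

open import Defs
open import Data.Integer as ℤ using (ℤ; +_; -[1+_])
import Data.Integer.Properties as ℤ
import Data.Integer.Tactic.RingSolver as ℤ-Solver
open import Data.Nat using (suc)
open import Data.Rational as ℚ using (ℚ; 0ℚ)
import Data.Rational.Properties as ℚ
open import Data.Rational.Unnormalised as ℚᵘ using (mkℚᵘ; *≡*)
import Data.Rational.Unnormalised.Properties as ℚᵘ
open import Data.Product using (_,_)
open import Data.Sum as Sum using (inj₁; inj₂; swap)
open import Data.List.Relation.Unary.Any using (here; there)
open import Data.List.Membership.Propositional using (_∈_)
open import Data.Maybe using (nothing)
open import Level using (0ℓ)
open import Relation.Binary.Core using (Rel)
open import Relation.Binary.Definitions using (Symmetric)
open import Relation.Binary.PropositionalEquality
open import Relation.Binary.Construct.Closure.ReflexiveTransitive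
  using (Star; ε; _◅_; _◅◅_; gmap; reverse)
open import Relation.Binary.Construct.Closure.ReflexiveTransitive.Properties
  using (module StarReasoning)
open import Tactic.RingSolver using (solve-∀)
import Tactic.RingSolver.Core.AlmostCommutativeRing as ACR

ℚ-ring : ACR.AlmostCommutativeRing 0ℓ 0ℓ
ℚ-ring = ACR.fromCommutativeRing ℚ.+-*-commutativeRing (λ _ → nothing)

Star-along-ℤ : ∀ {a ℓ} {A : Set a} {R : Rel A ℓ} → Symmetric R →
               (v : ℤ → A) → (∀ i → Star R (v i) (v (ℤ.suc i))) →
               ∀ i → Star R (v (+ 0)) (v i)
Star-along-ℤ R-sym v step (+ 0)           = ε
Star-along-ℤ R-sym v step (+ suc k)       = Star-along-ℤ R-sym v step (+ k) ◅◅ step (+ k)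
Star-along-ℤ R-sym v step -[1+ 0 ]        = reverse R-sym (step -[1+ 0 ])
Star-along-ℤ R-sym v step -[1+ suc k ]    =
  Star-along-ℤ R-sym v step -[1+ k ] ◅◅ reverse R-sym (step -[1+ suc k ])

ι : ℤ → ℚ
ι i = i ℚ./ 1

toℚᵘ-ι : ∀ i → ℚ.toℚᵘ (ι i) ℚᵘ.≃ mkℚᵘ i 0
toℚᵘ-ι i = ℚ.toℚᵘ-fromℚᵘ (mkℚᵘ i 0)

ι-homo-+ : ∀ i j → ι (i ℤ.+ j) ≡ ι i ℚ.+ ι j
ι-homo-+ i j = ℚ.toℚᵘ-injective (begin
  ℚ.toℚᵘ (ι (i ℤ.+ j))                 ≈⟨ toℚᵘ-ι (i ℤ.+ j) ⟩
  mkℚᵘ (i ℤ.+ j) 0                     ≈⟨ *≡* (cong₂ (λ p q → (p ℤ.+ q) ℤ.* + 1)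
                                              (sym (ℤ.*-identityʳ i)) (sym (ℤ.*-identityʳ j))) ⟩
  mkℚᵘ i 0 ℚᵘ.+ mkℚᵘ j 0               ≈⟨ ℚᵘ.+-cong (toℚᵘ-ι i) (toℚᵘ-ι j) ⟨
  ℚ.toℚᵘ (ι i) ℚᵘ.+ ℚ.toℚᵘ (ι j)       ≈⟨ ℚ.toℚᵘ-homo-+ (ι i) (ι j) ⟨
  ℚ.toℚᵘ (ι i ℚ.+ ι j)                 ∎)
  where open ℚᵘ.≃-Reasoning

ι-homo-* : ∀ i j → ι (i ℤ.* j) ≡ ι i ℚ.* ι j
ι-homo-* i j = ℚ.toℚᵘ-injective (begin
  ℚ.toℚᵘ (ι (i ℤ.* j))                 ≈⟨ toℚᵘ-ι (i ℤ.* j) ⟩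
  mkℚᵘ i 0 ℚᵘ.* mkℚᵘ j 0               ≈⟨ ℚᵘ.*-cong (toℚᵘ-ι i) (toℚᵘ-ι j) ⟨
  ℚ.toℚᵘ (ι i) ℚᵘ.* ℚ.toℚᵘ (ι j)       ≈⟨ ℚ.toℚᵘ-homo-* (ι i) (ι j) ⟨
  ℚ.toℚᵘ (ι i ℚ.* ι j)                 ∎)
  where open ℚᵘ.≃-Reasoning

ι-homo‿- : ∀ i → ι (ℤ.- i) ≡ ℚ.- ι i
ι-homo‿- i = ℚ.toℚᵘ-injective (begin
  ℚ.toℚᵘ (ι (ℤ.- i))                   ≈⟨ toℚᵘ-ι (ℤ.- i) ⟩
  ℚᵘ.- mkℚᵘ i 0                        ≈⟨ ℚᵘ.-‿cong (toℚᵘ-ι i) ⟨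
  ℚᵘ.- ℚ.toℚᵘ (ι i)                    ≈⟨ ℚ.toℚᵘ-homo‿- (ι i) ⟨
  ℚ.toℚᵘ (ℚ.- ι i)                     ∎)
  where open ℚᵘ.≃-Reasoning

ι-homo-− : ∀ i j → ι (i ℤ.- j) ≡ ι i ℚ.- ι j
ι-homo-− i j = trans (ι-homo-+ i (ℤ.- j)) (cong (ι i ℚ.+_) (ι-homo‿- j))

ι-homo-*-* : ∀ i j k → ι (i ℤ.* (j ℤ.* k)) ≡ ι i ℚ.* (ι j ℚ.* ι k)
ι-homo-*-* i j k = trans (ι-homo-* i (j ℤ.* k)) (cong (ι i ℚ.*_) (ι-homo-* j k))

kadd : K → K → K
kadd (p , q) (r , s) = (p ℚ.+ r , q ℚ.+ s)

emb-oadd : ∀ z w → emb (oadd z w) ≡ kadd (emb z) (emb w)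
emb-oadd (a , b) (c , e) = cong₂ _,_ (ι-homo-+ a c) (ι-homo-+ b e)

emb-omul : ∀ d z w → emb (omul d z w) ≡ kmul d (emb z) (emb w)
emb-omul d (a , b) (c , e) = cong₂ _,_
  (begin
    ι (a ℤ.* c ℤ.- Nm d ℤ.* (b ℤ.* e))          ≡⟨ ι-homo-− (a ℤ.* c) _ ⟩
    ι (a ℤ.* c) ℚ.- ι (Nm d ℤ.* (b ℤ.* e))      ≡⟨ cong₂ ℚ._-_ (ι-homo-* a c) (ι-homo-*-* (Nm d) b e) ⟩
    ι a ℚ.* ι c ℚ.- ι (Nm d) ℚ.* (ι b ℚ.* ι e)  ∎)
  (begin
    ι (a ℤ.* e ℤ.+ b ℤ.* c ℤ.+ Tr d ℤ.* (b ℤ.* e))              ≡⟨ ι-homo-+ (a ℤ.* e ℤ.+ b ℤ.* c) _ ⟩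
    ι (a ℤ.* e ℤ.+ b ℤ.* c) ℚ.+ ι (Tr d ℤ.* (b ℤ.* e))          ≡⟨ cong₂ ℚ._+_ (ι-homo-+ (a ℤ.* e) (b ℤ.* c))
                                                                     (ι-homo-*-* (Tr d) b e) ⟩
    ι (a ℤ.* e) ℚ.+ ι (b ℤ.* c) ℚ.+ ι (Tr d) ℚ.* (ι b ℚ.* ι e)  ≡⟨ cong₂ (λ p q → p ℚ.+ q ℚ.+ _)
                                                                     (ι-homo-* a e) (ι-homo-* b c) ⟩
    ι a ℚ.* ι e ℚ.+ ι b ℚ.* ι c ℚ.+ ι (Tr d) ℚ.* (ι b ℚ.* ι e)  ∎)
  where open ≡-Reasoning

kmul-distribʳ-kadd : ∀ d x y w → kmul d (kadd x y) w ≡ kadd (kmul d x w) (kmul d y w)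
kmul-distribʳ-kadd d (x₁ , x₂) (y₁ , y₂) (w₁ , w₂) =
  cong₂ _,_ (real-part x₁ x₂ y₁ y₂ w₁ w₂ (ι (Nm d))) (ω-part x₁ x₂ y₁ y₂ w₁ w₂ (ι (Tr d)))
  where
  real-part : ∀ x₁ x₂ y₁ y₂ w₁ w₂ N →
    (x₁ ℚ.+ y₁) ℚ.* w₁ ℚ.- N ℚ.* ((x₂ ℚ.+ y₂) ℚ.* w₂)
      ≡ (x₁ ℚ.* w₁ ℚ.- N ℚ.* (x₂ ℚ.* w₂)) ℚ.+ (y₁ ℚ.* w₁ ℚ.- N ℚ.* (y₂ ℚ.* w₂))
  real-part = solve-∀ ℚ-ring
  ω-part : ∀ x₁ x₂ y₁ y₂ w₁ w₂ T →
    (x₁ ℚ.+ y₁) ℚ.* w₂ ℚ.+ (x₂ ℚ.+ y₂) ℚ.* w₁ ℚ.+ T ℚ.* ((x₂ ℚ.+ y₂) ℚ.* w₂)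
      ≡ (x₁ ℚ.* w₂ ℚ.+ x₂ ℚ.* w₁ ℚ.+ T ℚ.* (x₂ ℚ.* w₂)) ℚ.+ (y₁ ℚ.* w₂ ℚ.+ y₂ ℚ.* w₁ ℚ.+ T ℚ.* (y₂ ℚ.* w₂))
  ω-part = solve-∀ ℚ-ring

-- The matrix (1 u ; 0 1) · A.
translateMat : D → O → Mat → Mat
translateMat d u (mat a b c e) = mat (oadd a (omul d u c)) (oadd b (omul d u e)) c e

det-translateMat : ∀ d u A → det d (translateMat d u A) ≡ det d A
det-translateMat d (u₁ , u₂) (mat (a₁ , a₂) (b₁ , b₂) (c₁ , c₂) (e₁ , e₂)) =
  cong₂ _,_ (real-part (Tr d) (Nm d) u₁ u₂ a₁ a₂ b₁ b₂ c₁ c₂ e₁ e₂)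
            (ω-part (Tr d) (Nm d) u₁ u₂ a₁ a₂ b₁ b₂ c₁ c₂ e₁ e₂)
  where
  open import Data.Integer using (_+_; _*_; _-_)
  real-part : ∀ T N u₁ u₂ a₁ a₂ b₁ b₂ c₁ c₂ e₁ e₂ →
    let re = λ x₁ x₂ y₁ y₂ → x₁ * y₁ - N * (x₂ * y₂)
        im = λ x₁ x₂ y₁ y₂ → x₁ * y₂ + x₂ * y₁ + T * (x₂ * y₂)
    in   re (a₁ + re u₁ u₂ c₁ c₂) (a₂ + im u₁ u₂ c₁ c₂) e₁ e₂
       - re (b₁ + re u₁ u₂ e₁ e₂) (b₂ + im u₁ u₂ e₁ e₂) c₁ c₂
       ≡ re a₁ a₂ e₁ e₂ - re b₁ b₂ c₁ c₂
  real-part = ℤ-Solver.solve-∀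
  ω-part : ∀ T N u₁ u₂ a₁ a₂ b₁ b₂ c₁ c₂ e₁ e₂ →
    let re = λ x₁ x₂ y₁ y₂ → x₁ * y₁ - N * (x₂ * y₂)
        im = λ x₁ x₂ y₁ y₂ → x₁ * y₂ + x₂ * y₁ + T * (x₂ * y₂)
    in   im (a₁ + re u₁ u₂ c₁ c₂) (a₂ + im u₁ u₂ c₁ c₂) e₁ e₂
       - im (b₁ + re u₁ u₂ e₁ e₂) (b₂ + im u₁ u₂ e₁ e₂) c₁ c₂
       ≡ im a₁ a₂ e₁ e₂ - im b₁ b₂ c₁ c₂
  ω-part = ℤ-Solver.solve-∀

HomPt-translate : ∀ d u {num den x} → HomPt d num den (fin x) →
                  HomPt d (oadd num (omul d u den)) den (fin (kadd x (emb u)))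
HomPt-translate d u {num} {den} {x} (den≢0 , x*den≡num) = den≢0 , (begin
  kmul d (kadd x (emb u)) (emb den)                  ≡⟨ kmul-distribʳ-kadd d x (emb u) (emb den) ⟩
  kadd (kmul d x (emb den)) (kmul d (emb u) (emb den)) ≡⟨ cong₂ kadd x*den≡num (sym (emb-omul d u den)) ⟩
  kadd (emb num) (emb (omul d u den))                ≡⟨ emb-oadd num (omul d u den) ⟨
  emb (oadd num (omul d u den))                      ∎)
  where open ≡-Reasoning

Arrow-translate : ∀ d u {x y} → Arrow d (fin x) (fin y) →
                  Arrow d (fin (kadd x (emb u))) (fin (kadd y (emb u)))
Arrow-translate d u {x} {y} (A@(mat a b c e) , det≡1 , A∞ , A0) =
  translateMat d u A , trans (det-translateMat d u A) det≡1 ,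
  HomPt-translate d u {a} {c} {x} A∞ , HomPt-translate d u {b} {e} {y} A0

Edge-translate : ∀ d u {x y} → Edge d (fin x) (fin y) →
                 Edge d (fin (kadd x (emb u))) (fin (kadd y (emb u)))
Edge-translate d u {x} {y} = Sum.map (Arrow-translate d u {x} {y}) (Arrow-translate d u {y} {x})

0ₒ 1ₒ ωₒ : O
0ₒ = (+ 0 , + 0)
1ₒ = (+ 1 , + 0)
ωₒ = (+ 0 , + 1)

point : O → ℚ → K
point z t = kadd (emb z) (0ℚ , t)

point-translate : ∀ z t u → kadd (point z t) (emb u) ≡ point (oadd z u) t
point-translate (z₁ , z₂) t (u₁ , u₂) = cong₂ _,_
  (trans (+-swapʳ (ι z₁) 0ℚ (ι u₁)) (cong (ℚ._+ 0ℚ) (sym (ι-homo-+ z₁ u₁))))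
  (trans (+-swapʳ (ι z₂) t (ι u₂)) (cong (ℚ._+ t) (sym (ι-homo-+ z₂ u₂))))
  where
  +-swapʳ : ∀ p q r → (p ℚ.+ q) ℚ.+ r ≡ (p ℚ.+ r) ℚ.+ q
  +-swapʳ = solve-∀ ℚ-ring

oadd-identityˡ : ∀ z → oadd 0ₒ z ≡ z
oadd-identityˡ (m , n) = cong₂ _,_ (ℤ.+-identityˡ m) (ℤ.+-identityˡ n)

vertex : ∀ {d} (z : O) {t} → t ∈ offsets d → GV d
vertex z {t} t∈ = fin (point z t) , z , t , t∈ , refl

0∈offsets : ∀ d → 0ℚ ∈ offsets d
0∈offsets d2  = here refl
0∈offsets d7  = here refl
0∈offsets d11 = here refl

lattice : ∀ {d} → O → GV d
lattice {d} z = vertex z (0∈offsets d)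

Walk : (d : D) → GV d → GV d → Set
Walk d = Star (GEdge d)

Walk-sym : ∀ d → Symmetric (Walk d)
Walk-sym d = reverse swap

translate : ∀ {d} → O → GV d → GV d
translate u (∞ , ())
translate u (fin _ , z , t , t∈ , _) = vertex (oadd z u) t∈

GEdge-translate : ∀ d u {x y} → GEdge d x y → GEdge d (translate u x) (translate u y)
GEdge-translate d u {∞ , ()}
GEdge-translate d u {fin _ , _ , _ , _ , _} {∞ , ()}
GEdge-translate d u {fin _ , z , t , _ , refl} {fin _ , z′ , t′ , _ , refl} e =
  subst₂ (λ p q → Edge d (fin p) (fin q)) (point-translate z t u) (point-translate z′ t′ u)
         (Edge-translate d u {point z t} {point z′ t′} e)

Walk-translate : ∀ d u {x y} → Walk d x y → Walk d (translate u x) (translate u y)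
Walk-translate d u = gmap (translate u) (GEdge-translate d u)

Walk-translate-origin : ∀ d z {u z′ t} {t∈ : t ∈ offsets d} →
                        Walk d (lattice 0ₒ) (vertex u t∈) → oadd u z ≡ z′ →
                        Walk d (lattice z) (vertex z′ t∈)
Walk-translate-origin d z {u} {t∈ = t∈} w refl =
  subst (λ v → Walk d (lattice v) (vertex (oadd u z) t∈)) (oadd-identityˡ z) (Walk-translate d z w)

-- Every explicit edge below is certified by evaluation (det A = 1, the images of ∞ and 0
-- by refl, nonzero denominators by λ ()), which needs d to be a constructor.
0—1 : ∀ d → Walk d (lattice 0ₒ) (lattice 1ₒ)
0—1 d2  = inj₁ (mat 0ₒ 1ₒ (-[1+ 0 ] , + 0) 1ₒ , refl , ((λ ()) , refl) , ((λ ()) , refl)) ◅ ε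
0—1 d7  = inj₁ (mat 0ₒ 1ₒ (-[1+ 0 ] , + 0) 1ₒ , refl , ((λ ()) , refl) , ((λ ()) , refl)) ◅ ε
0—1 d11 = inj₁ (mat 0ₒ 1ₒ (-[1+ 0 ] , + 0) 1ₒ , refl , ((λ ()) , refl) , ((λ ()) , refl)) ◅ ε

module Walks₂ where
  open StarReasoning (GEdge d2)

  ½∈ : half ∈ offsets d2
  ½∈ = there (here refl)

  0—½ω : Walk d2 (lattice 0ₒ) (vertex 0ₒ ½∈)
  0—½ω = begin
    lattice 0ₒ   ⟶⟨ inj₂ (mat (-[1+ 0 ] , + 0) 0ₒ ωₒ (-[1+ 0 ] , + 0) , refl , ((λ ()) , refl) , ((λ ()) , refl)) ⟩
    vertex 0ₒ ½∈ ∎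

  0—ω : Walk d2 (lattice 0ₒ) (lattice ωₒ)
  0—ω = begin
    lattice 0ₒ   ⟶*⟨ 0—½ω ⟩
    vertex 0ₒ ½∈ ⟶⟨ inj₁ (mat (-[1+ 0 ] , + 0) ωₒ ωₒ 1ₒ , refl , ((λ ()) , refl) , ((λ ()) , refl)) ⟩
    lattice ωₒ   ∎

module Walks₇ where
  open StarReasoning (GEdge d7)

  ½∈ : half ∈ offsets d7
  ½∈ = there (here refl)

  0—½ω : Walk d7 (lattice 0ₒ) (vertex 0ₒ ½∈)
  0—½ω = begin
    lattice 0ₒ   ⟶⟨ inj₂ (mat 1ₒ 0ₒ (+ 1 , -[1+ 0 ]) 1ₒ , refl , ((λ ()) , refl) , ((λ ()) , refl)) ⟩
    vertex 0ₒ ½∈ ∎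

  0—ω : Walk d7 (lattice 0ₒ) (lattice ωₒ)
  0—ω = begin
    lattice 0ₒ   ⟶*⟨ 0—½ω ⟩
    vertex 0ₒ ½∈ ⟶⟨ inj₁ (mat (-[1+ 0 ] , + 0) ωₒ (-[1+ 0 ] , + 1) 1ₒ , refl , ((λ ()) , refl) , ((λ ()) , refl)) ⟩
    lattice ωₒ   ∎

module Walks₁₁ where
  open StarReasoning (GEdge d11)

  ⅓∈ : third ∈ offsets d11
  ⅓∈ = there (here refl)

  ½∈ : half ∈ offsets d11
  ½∈ = there (there (here refl))

  ⅔∈ : twothirds ∈ offsets d11
  ⅔∈ = there (there (there (here refl)))

  0—⅓ω : Walk d11 (lattice 0ₒ) (vertex 0ₒ ⅓∈)
  0—⅓ω = begin
    lattice 0ₒ   ⟶⟨ inj₂ (mat 1ₒ 0ₒ (+ 1 , -[1+ 0 ]) 1ₒ , refl , ((λ ()) , refl) , ((λ ()) , refl)) ⟩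
    vertex 0ₒ ⅓∈ ∎

  0—½ω : Walk d11 (lattice 0ₒ) (vertex 0ₒ ½∈)
  0—½ω = begin
    lattice 0ₒ   ⟶*⟨ 0—⅓ω ⟩
    vertex 0ₒ ⅓∈ ⟶⟨ inj₂ (mat ωₒ 1ₒ (+ 2 , + 0) (+ 1 , -[1+ 0 ]) , refl , ((λ ()) , refl) , ((λ ()) , refl)) ⟩
    vertex 0ₒ ½∈ ∎

  0—⅔ω : Walk d11 (lattice 0ₒ) (vertex 0ₒ ⅔∈)
  0—⅔ω = begin
    lattice 0ₒ   ⟶*⟨ 0—½ω ⟩
    vertex 0ₒ ½∈ ⟶⟨ inj₁ (mat ωₒ (-[1+ 1 ] , + 0) (+ 2 , + 0) (-[1+ 0 ] , + 1) , refl , ((λ ()) , refl) , ((λ ()) , refl)) ⟩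
    vertex 0ₒ ⅔∈ ∎

  0—ω : Walk d11 (lattice 0ₒ) (lattice ωₒ)
  0—ω = begin
    lattice 0ₒ   ⟶*⟨ 0—⅔ω ⟩
    vertex 0ₒ ⅔∈ ⟶⟨ inj₁ (mat (-[1+ 1 ] , + 0) ωₒ (-[1+ 0 ] , + 1) 1ₒ , refl , ((λ ()) , refl) , ((λ ()) , refl)) ⟩
    lattice ωₒ   ∎

0—ω : ∀ d → Walk d (lattice 0ₒ) (lattice ωₒ)
0—ω d2  = Walks₂.0—ω
0—ω d7  = Walks₇.0—ω
0—ω d11 = Walks₁₁.0—ω

0—tω : ∀ d {t} (t∈ : t ∈ offsets d) → Walk d (lattice 0ₒ) (vertex 0ₒ t∈)
0—tω d2  (here refl)                         = ε
0—tω d2  (there (here refl))                 = Walks₂.0—½ω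
0—tω d7  (here refl)                         = ε
0—tω d7  (there (here refl))                 = Walks₇.0—½ω
0—tω d11 (here refl)                         = ε
0—tω d11 (there (here refl))                 = Walks₁₁.0—⅓ω
0—tω d11 (there (there (here refl)))         = Walks₁₁.0—½ω
0—tω d11 (there (there (there (here refl)))) = Walks₁₁.0—⅔ω

0—lattice : ∀ d z → Walk d (lattice 0ₒ) (lattice z)
0—lattice d (m , n) =
  Star-along-ℤ swap (λ i → lattice (i , + 0))
    (λ i → Walk-translate-origin d (i , + 0) (0—1 d) refl) m ◅◅
  Star-along-ℤ swap (λ j → lattice (m , j))
    (λ j → Walk-translate-origin d (m , j) (0—ω d) (cong (_, ℤ.suc j) (ℤ.+-identityˡ m))) n

0—vertex : ∀ d x → Walk d (lattice 0ₒ) x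
0—vertex d (∞ , ())
0—vertex d (fin _ , z , t , t∈ , refl) =
  0—lattice d z ◅◅ Walk-translate-origin d z (0—tω d t∈) (oadd-identityˡ z)

proposition3 : (d : D) → InducedConnected d
proposition3 d x y = Walk-sym d (0—vertex d x) ◅◅ 0—vertex d y
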